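{- Let $D$ be a deck of order $n$, length $\ell$, with $c$ cards, and let $\mu=\min_{s\in S}m(s)$, $M=\max_{s\in S}m(s)$ and $\Delta_n=n^2-n+1$. Then: 1. $n+1\leq n(\mu-1)+1\leq c\leq n(M-1)+1\leq\Delta_n$; 2. $c\leq n(M-1)+1\leq M(n-1)+1\leq\ell$; 3. there exists a value $k$ such that at least $n+1$ symbols have multiplicity $k$.
   Context: A deck consists of a finite set $S$ of symbols together with a finite collection $D$ of distinct cards, each card being a subset of $S$, satisfying: (D1) any two distinct cards have exactly one symbol in common; (D2) every symbol of $S$ lies on at least two cards; (D3) every card contains at least two symbols; (D4) all cards have the same cardinality $n$ (the order); (D5) $S$ is nonempty. $\ell=|S|$ is the length and $c=|D|$ the number of cards. For $s\in S$, the multiplicity $m(s)$ is the number of cards containing $s$. -}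

module Defs where

open import Data.Nat using (ℕ; suc; _+_; _*_; _∸_; _≤_; NonZero)
open import Data.Bool using (Bool; true; false; if_then_else_)
open import Data.Fin using (Fin)
open import Data.Fin.Subset using (Subset; _∩_; ∣_∣)
open import Data.Vec using (lookup; tabulate)
open import Data.Product using (Σ; ∃; _×_)
open import Relation.Binary.PropositionalEquality using (_≡_; _≢_)
open import Relation.Nullary using (does)
open import Data.Nat using (_≟_)

-- A deck with symbol set S = Fin ℓ and c cards, indexed by Fin c.
record Deck (ℓ c n : ℕ) : Set where
  field
    card     : Fin c → Subset ℓ
    distinct : ∀ i j → card i ≡ card j → i ≡ j
    D1 : ∀ i j → i ≢ j → ∣ card i ∩ card j ∣ ≡ 1
    D2 : ∀ (s : Fin ℓ) → 2 ≤ ∣ tabulate (λ i → lookup (card i) s) ∣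
    D3 : ∀ i → 2 ≤ ∣ card i ∣
    D4 : ∀ i → ∣ card i ∣ ≡ n
    D5 : 1 ≤ ℓ

mult : ∀ {ℓ c n} → Deck ℓ c n → Fin ℓ → ℕ
mult D s = ∣ tabulate (λ i → lookup (Deck.card D i) s) ∣

IsMinMult : ∀ {ℓ c n} → Deck ℓ c n → ℕ → Set
IsMinMult D μ = (∃ λ s → mult D s ≡ μ) × (∀ s → μ ≤ mult D s)

IsMaxMult : ∀ {ℓ c n} → Deck ℓ c n → ℕ → Set
IsMaxMult D M = (∃ λ s → mult D s ≡ M) × (∀ s → mult D s ≤ M)

multSet : ∀ {ℓ c n} → Deck ℓ c n → ℕ → Subset ℓ
multSet D k = tabulate (λ s → does (mult D s ≟ k))

Δ : ℕ → ℕ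
Δ n = n * n ∸ n + 1

-- Everything comes from double counting incidences between symbols and cards.
-- Summing m(s) over the n symbols s of a card C counts C itself n times and every
-- other card exactly once, so n·μ ≤ n + (c − 1) ≤ n·M. Two symbols lie together on
-- at most one card; hence, for a card C missing s, the cards through s meet C in
-- distinct symbols, so m(s) ≤ n, while the cards through s cover m(s)(n − 1) + 1
-- distinct symbols, so M(n − 1) + 1 ≤ ℓ. Finally the multiplicities take at most
-- M − 1 values (all in [2, M]), and (M − 1)·n ≤ M(n − 1) < ℓ forces one of these
-- values to be taken by more than n symbols.
module Submission where

open import Data.Bool using (Bool; true; false; _∧_)
open import Data.Bool.Properties using (¬-not)
open import Data.Fin using (Fin; zero; suc; toℕ; fromℕ<; punchIn; punchOut; _≟_)
open import Data.Fin.Properties using (punchInᵢ≢i; punchIn-punchOut; toℕ-fromℕ<; toℕ<n)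
open import Data.Fin.Subset using (Subset; _∩_; ∣_∣)
open import Data.Nat using (ℕ; zero; suc; _+_; _*_; _∸_; _≤_; _<_; z≤n; s≤s; z<s; _≤?_; _<?_)
  renaming (_≟_ to _≟ℕ_)
open import Data.Nat.Properties hiding (_≟_)
open import Data.Product using (∃; _×_; _,_)
open import Data.Vec using (_∷_; []; lookup; tabulate)
open import Data.Vec.Functional using (Vector; removeAt)
open import Data.Vec.Properties using (lookup∘tabulate; lookup-zipWith)
open import Function using (_∘_)
open import Relation.Binary.PropositionalEquality
open import Relation.Nullary using (yes; no; does; contradiction)
open import Relation.Nullary.Decidable using (dec-true)

open import Algebra.Properties.Semiring.Sum +-*-semiring
  using (sum; sum-syntax; sum-remove; sum-cong-≗; ∑-comm; *-distribˡ-sum; *-distribʳ-sum)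

open import Defs

sum-mono-≤ : ∀ {k} {f g : Vector ℕ k} → (∀ i → f i ≤ g i) → sum f ≤ sum g
sum-mono-≤ {zero}  _   = z≤n
sum-mono-≤ {suc k} f≤g = +-mono-≤ (f≤g zero) (sum-mono-≤ (f≤g ∘ suc))

∑-const : ∀ k x → ∑[ i < k ] x ≡ k * x
∑-const zero    x = refl
∑-const (suc k) x = cong (x +_) (∑-const k x)

lookup≤sum : ∀ {k} (f : Vector ℕ k) i → f i ≤ sum f
lookup≤sum {suc k} f i = ≤-trans (m≤m+n (f i) _) (≤-reflexive (sym (sum-remove f)))

sum-except-≤ : ∀ {k x} (f : Vector ℕ k) i → (∀ j → j ≢ i → f j ≤ x) → sum f ≤ f i + (k ∸ 1) * x
sum-except-≤ {suc k} {x} f i others = begin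
  sum f                     ≡⟨ sum-remove f ⟩
  f i + sum (removeAt f i)  ≤⟨ +-monoʳ-≤ (f i) (sum-mono-≤ (λ j → others (punchIn i j) (punchInᵢ≢i i j))) ⟩
  f i + ∑[ j < k ] x        ≡⟨ cong (f i +_) (∑-const k x) ⟩
  f i + k * x               ∎
  where open ≤-Reasoning

sum-except-≡ : ∀ {k x} (f : Vector ℕ k) i → (∀ j → j ≢ i → f j ≡ x) → sum f ≡ f i + (k ∸ 1) * x
sum-except-≡ {suc k} {x} f i others = begin
  sum f                     ≡⟨ sum-remove f ⟩
  f i + sum (removeAt f i)  ≡⟨ cong (f i +_) (sum-cong-≗ (λ j → others (punchIn i j) (punchInᵢ≢i i j))) ⟩
  f i + ∑[ j < k ] x        ≡⟨ cong (f i +_) (∑-const k x) ⟩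
  f i + k * x               ∎
  where open ≡-Reasoning

k*x<sum⇒∃x< : ∀ {k x} (f : Vector ℕ k) → k * x < sum f → ∃ λ i → x < f i
k*x<sum⇒∃x< {suc k} {x} f kx<∑ with x <? f zero
... | yes x<f₀ = zero , x<f₀
... | no  x≮f₀ with k*x<sum⇒∃x< (f ∘ suc) (+-cancelˡ-< x _ _ (<-≤-trans kx<∑ (+-monoˡ-≤ _ (≮⇒≥ x≮f₀))))
...   | i , x<fᵢ = suc i , x<fᵢ

∧-true : ∀ {a b} → a ∧ b ≡ true → a ≡ true × b ≡ true
∧-true {true} {true} _ = refl , refl

𝟙 : Bool → ℕ
𝟙 true  = 1
𝟙 false = 0

𝟙≤1 : ∀ b → 𝟙 b ≤ 1
𝟙≤1 true  = s≤s z≤n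
𝟙≤1 false = z≤n

𝟙-pos : ∀ {b} → 0 < 𝟙 b → b ≡ true
𝟙-pos {true} _ = refl

𝟙-∧ : ∀ a b → 𝟙 (a ∧ b) ≡ 𝟙 a * 𝟙 b
𝟙-∧ true  b = sym (+-identityʳ (𝟙 b))
𝟙-∧ false b = refl

𝟙-idem : ∀ a → 𝟙 a * 𝟙 a ≡ 𝟙 a
𝟙-idem true  = refl
𝟙-idem false = refl

count : ∀ {k} → (Fin k → Bool) → ℕ
count {k} g = ∑[ i < k ] 𝟙 (g i)

∣p∣≡count : ∀ {k} (p : Subset k) → ∣ p ∣ ≡ count (lookup p)
∣p∣≡count []          = refl
∣p∣≡count (true ∷ p)  = cong suc (∣p∣≡count p)
∣p∣≡count (false ∷ p) = ∣p∣≡count p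

∣tabulate∣≡count : ∀ {k} (g : Fin k → Bool) → ∣ tabulate g ∣ ≡ count g
∣tabulate∣≡count g = trans (∣p∣≡count (tabulate g)) (sum-cong-≗ (cong 𝟙 ∘ lookup∘tabulate g))

0<count⇒∃ : ∀ {k} (g : Fin k → Bool) → 0 < count g → ∃ λ i → g i ≡ true
0<count⇒∃ {k} g 0<count with k*x<sum⇒∃x< (𝟙 ∘ g) (subst (_< count g) (sym (*-zeroʳ k)) 0<count)
... | i , 0<𝟙 = i , 𝟙-pos 0<𝟙

two-true⇒2≤count : ∀ {k} (g : Fin k → Bool) {i j} → g i ≡ true → g j ≡ true → i ≢ j → 2 ≤ count g
two-true⇒2≤count {suc k} g {i} {j} gᵢ gⱼ i≢j = begin
  1 + 1                                       ≡⟨ cong₂ (λ a b → 𝟙 a + 𝟙 b) (sym gᵢ) (sym gⱼ′) ⟩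
  𝟙 (g i) + 𝟙 (g (punchIn i (punchOut i≢j)))  ≤⟨ +-monoʳ-≤ (𝟙 (g i)) (lookup≤sum (removeAt (𝟙 ∘ g) i) _) ⟩
  𝟙 (g i) + sum (removeAt (𝟙 ∘ g) i)          ≡⟨ sum-remove (𝟙 ∘ g) ⟨
  count g                                     ∎
  where
  open ≤-Reasoning
  gⱼ′ : g (punchIn i (punchOut i≢j)) ≡ true
  gⱼ′ = trans (cong g (punchIn-punchOut i≢j)) gⱼ

2≤count⇒∃≢ : ∀ {k} (g : Fin k → Bool) → 2 ≤ count g → ∀ i → ∃ λ j → j ≢ i × g j ≡ true
2≤count⇒∃≢ {suc k} g 2≤count i =
  let j , gⱼ = 0<count⇒∃ (g ∘ punchIn i) 0<rest in punchIn i j , punchInᵢ≢i i j , gⱼ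
  where
  0<rest : 0 < count (g ∘ punchIn i)
  0<rest = +-cancelˡ-≤ 1 1 _ (begin
    1 + 1                                ≤⟨ 2≤count ⟩
    count g                              ≡⟨ sum-remove (𝟙 ∘ g) ⟩
    𝟙 (g i) + count (g ∘ punchIn i)      ≤⟨ +-monoˡ-≤ _ (𝟙≤1 (g i)) ⟩
    1 + count (g ∘ punchIn i)            ∎)
    where open ≤-Reasoning

unique⇒count≤1 : ∀ {k} (g : Fin k → Bool) → (∀ {i j} → g i ≡ true → g j ≡ true → i ≡ j) → count g ≤ 1
unique⇒count≤1 g unique with count g ≤? 1
... | yes count≤1 = count≤1
... | no  count≰1 with 0<count⇒∃ g (≤-trans (s≤s z≤n) (≰⇒> count≰1))
...   | i , gᵢ with 2≤count⇒∃≢ g (≰⇒> count≰1) i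
...     | j , j≢i , gⱼ = contradiction (unique gⱼ gᵢ) j≢i

pigeonhole : ∀ {ℓ x} (f : Fin ℓ → ℕ) lo K → (∀ s → lo ≤ f s) → (∀ s → f s < lo + K) → K * x < ℓ →
             ∃ λ k → x < ∣ tabulate (λ s → does (f s ≟ℕ lo + toℕ k)) ∣
pigeonhole {ℓ} f lo K lo≤f f<lo+K Kx<ℓ = k*x<sum⇒∃x< {K} _ (<-≤-trans Kx<ℓ ℓ≤∑∣fibre∣)
  where
  hits : Fin ℓ → Fin K → Bool
  hits s k = does (f s ≟ℕ lo + toℕ k)

  fibres-cover : ∀ s → 1 ≤ count (hits s)
  fibres-cover s = ≤-trans (≤-reflexive (cong 𝟙 (sym (dec-true (f s ≟ℕ lo + toℕ k) fs≡lo+k))))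
                           (lookup≤sum {K} (𝟙 ∘ hits s) k)
    where
    k : Fin K
    k = fromℕ< (+-cancelˡ-< lo _ _ (subst (_< lo + K) (sym (m+[n∸m]≡n (lo≤f s))) (f<lo+K s)))
    fs≡lo+k : f s ≡ lo + toℕ k
    fs≡lo+k = sym (trans (cong (lo +_) (toℕ-fromℕ< _)) (m+[n∸m]≡n (lo≤f s)))

  ℓ≤∑∣fibre∣ : ℓ ≤ ∑[ k < K ] ∣ tabulate (λ s → hits s k) ∣
  ℓ≤∑∣fibre∣ = begin
    ℓ                                          ≡⟨ trans (∑-const ℓ 1) (*-identityʳ ℓ) ⟨
    ∑[ s < ℓ ] 1                               ≤⟨ sum-mono-≤ {ℓ} fibres-cover ⟩
    ∑[ s < ℓ ] ∑[ k < K ] 𝟙 (hits s k)         ≡⟨ ∑-comm {ℓ} {K} (λ s k → 𝟙 (hits s k)) ⟩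
    ∑[ k < K ] ∑[ s < ℓ ] 𝟙 (hits s k)         ≡⟨ sum-cong-≗ {K} (λ k → ∣tabulate∣≡count (λ s → hits s k)) ⟨
    ∑[ k < K ] ∣ tabulate (λ s → hits s k) ∣   ∎
    where open ≤-Reasoning

m*n≤m+o⇒m*[n∸1]≤o : ∀ m n {o} → m * n ≤ m + o → m * (n ∸ 1) ≤ o
m*n≤m+o⇒m*[n∸1]≤o m zero    _  = ≤-trans (≤-reflexive (*-zeroʳ m)) z≤n
m*n≤m+o⇒m*[n∸1]≤o m (suc n) le = +-cancelˡ-≤ m _ _ (≤-trans (≤-reflexive (sym (*-suc m n))) le)

m+o≤m*n⇒o≤m*[n∸1] : ∀ m n {o} → m + o ≤ m * n → o ≤ m * (n ∸ 1)
m+o≤m*n⇒o≤m*[n∸1] m zero    le = ≤-trans (m≤n+m _ m) le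
m+o≤m*n⇒o≤m*[n∸1] m (suc n) le = +-cancelˡ-≤ m _ _ (≤-trans le (≤-reflexive (*-suc m n)))

m*n≤m+[o∸1]⇒m*[n∸1]+1≤o : ∀ m n {o} → 1 ≤ o → m * n ≤ m + (o ∸ 1) → m * (n ∸ 1) + 1 ≤ o
m*n≤m+[o∸1]⇒m*[n∸1]+1≤o m n 1≤o le = ≤-trans (+-monoˡ-≤ 1 (m*n≤m+o⇒m*[n∸1]≤o m n le)) (≤-reflexive (m∸n+n≡m 1≤o))

m+[o∸1]≤m*n⇒o≤m*[n∸1]+1 : ∀ m n {o} → m + (o ∸ 1) ≤ m * n → o ≤ m * (n ∸ 1) + 1
m+[o∸1]≤m*n⇒o≤m*[n∸1]+1 m n {o} le =
  ≤-trans (≤-trans (m≤n+m∸n o 1) (≤-reflexive (+-comm 1 (o ∸ 1)))) (+-monoˡ-≤ 1 (m+o≤m*n⇒o≤m*[n∸1] m n le))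

2≤m⇒n≤n*[m∸1] : ∀ n {m} → 2 ≤ m → n ≤ n * (m ∸ 1)
2≤m⇒n≤n*[m∸1] n {suc (suc m)} (s≤s (s≤s z≤n)) = m≤m*n n (suc m)

m≤n⇒n*[m∸1]≤m*[n∸1] : ∀ {m n} → m ≤ n → n * (m ∸ 1) ≤ m * (n ∸ 1)
m≤n⇒n*[m∸1]≤m*[n∸1] {zero}  {n}     _         = ≤-trans (≤-reflexive (*-zeroʳ n)) z≤n
m≤n⇒n*[m∸1]≤m*[n∸1] {suc m} {suc n} (s≤s m≤n) = +-mono-≤ m≤n (≤-reflexive (*-comm n m))

m≤n⇒n*[m∸1]≤n*n∸n : ∀ {m n} → m ≤ n → n * (m ∸ 1) ≤ n * n ∸ n
m≤n⇒n*[m∸1]≤n*n∸n {m} {n} m≤n = ≤-trans (*-monoʳ-≤ n (∸-monoˡ-≤ 1 m≤n))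
                                         (≤-reflexive (trans (*-distribˡ-∸ n n 1) (cong (n * n ∸_) (*-identityʳ n))))

m≤n∧m*[n∸1]+1≤o⇒[m∸1]*n<o : ∀ {m n o} → m ≤ n → m * (n ∸ 1) + 1 ≤ o → (m ∸ 1) * n < o
m≤n∧m*[n∸1]+1≤o⇒[m∸1]*n<o {m} {n} {o} m≤n le = begin-strict
  (m ∸ 1) * n      ≡⟨ *-comm (m ∸ 1) n ⟩
  n * (m ∸ 1)      ≤⟨ m≤n⇒n*[m∸1]≤m*[n∸1] m≤n ⟩
  m * (n ∸ 1)      <⟨ m<m+n _ z<s ⟩
  m * (n ∸ 1) + 1  ≤⟨ le ⟩
  o                ∎
  where open ≤-Reasoning

module _ {ℓ c n} (D : Deck ℓ c n) where
  open Deck D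

  _∈ᶜ_ : Fin ℓ → Fin c → Set
  s ∈ᶜ j = lookup (card j) s ≡ true

  χ : Fin c → Fin ℓ → ℕ
  χ j s = 𝟙 (lookup (card j) s)

  ∑χ≡n : ∀ j → ∑[ s < ℓ ] χ j s ≡ n
  ∑χ≡n j = trans (sym (∣p∣≡count (card j))) (D4 j)

  mult≡∑χ : ∀ s → mult D s ≡ ∑[ j < c ] χ j s
  mult≡∑χ s = ∣tabulate∣≡count (λ j → lookup (card j) s)

  ∣cardᵢ∩cardⱼ∣≡∑ₛχᵢχⱼ : ∀ i j → ∣ card i ∩ card j ∣ ≡ ∑[ s < ℓ ] (χ i s * χ j s)
  ∣cardᵢ∩cardⱼ∣≡∑ₛχᵢχⱼ i j = trans (∣p∣≡count (card i ∩ card j)) (sum-cong-≗ (λ s →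
    trans (cong 𝟙 (lookup-zipWith _∧_ s (card i) (card j))) (𝟙-∧ (lookup (card i) s) (lookup (card j) s))))

  ∑ₛχᵢχᵢ≡n : ∀ i → ∑[ s < ℓ ] (χ i s * χ i s) ≡ n
  ∑ₛχᵢχᵢ≡n i = trans (sum-cong-≗ (λ s → 𝟙-idem (lookup (card i) s))) (∑χ≡n i)

  ∑ₛχᵢχⱼ≡1 : ∀ {i j} → i ≢ j → ∑[ s < ℓ ] (χ i s * χ j s) ≡ 1
  ∑ₛχᵢχⱼ≡1 {i} {j} i≢j = trans (sym (∣cardᵢ∩cardⱼ∣≡∑ₛχᵢχⱼ i j)) (D1 i j i≢j)

  card-through-two-unique : ∀ {s t i j} → s ≢ t → s ∈ᶜ i → t ∈ᶜ i → s ∈ᶜ j → t ∈ᶜ j → i ≡ j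
  card-through-two-unique {s} {t} {i} {j} s≢t s∈i t∈i s∈j t∈j with i ≟ j
  ... | yes i≡j = i≡j
  ... | no  i≢j = contradiction (D1 i j i≢j) (>⇒≢ (begin
    2                                 ≤⟨ two-true⇒2≤count (lookup (card i ∩ card j)) (both s∈i s∈j) (both t∈i t∈j) s≢t ⟩
    count (lookup (card i ∩ card j))  ≡⟨ ∣p∣≡count (card i ∩ card j) ⟨
    ∣ card i ∩ card j ∣               ∎))
    where
    open ≤-Reasoning
    both : ∀ {u} → u ∈ᶜ i → u ∈ᶜ j → lookup (card i ∩ card j) u ≡ true
    both {u} u∈i u∈j = trans (lookup-zipWith _∧_ u (card i) (card j)) (cong₂ _∧_ u∈i u∈j)

  ∑ⱼχₛχₜ≤1 : ∀ {s t} → s ≢ t → ∑[ j < c ] (χ j s * χ j t) ≤ 1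
  ∑ⱼχₛχₜ≤1 {s} {t} s≢t = begin
    ∑[ j < c ] (χ j s * χ j t)                           ≡⟨ sum-cong-≗ (λ j → 𝟙-∧ (lookup (card j) s) (lookup (card j) t)) ⟨
    count (λ j → lookup (card j) s ∧ lookup (card j) t)  ≤⟨ unique⇒count≤1 _ unique ⟩
    1                                                    ∎
    where
    open ≤-Reasoning
    unique : ∀ {i j} → (lookup (card i) s ∧ lookup (card i) t) ≡ true →
             (lookup (card j) s ∧ lookup (card j) t) ≡ true → i ≡ j
    unique stᵢ stⱼ = let s∈i , t∈i = ∧-true stᵢ ; s∈j , t∈j = ∧-true stⱼ in
                     card-through-two-unique s≢t s∈i t∈i s∈j t∈j

  ∃-card-through : ∀ s → ∃ λ j → s ∈ᶜ j
  ∃-card-through s = 0<count⇒∃ (λ j → lookup (card j) s) (≤-trans (s≤s z≤n) (subst (2 ≤_) (mult≡∑χ s) (D2 s)))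

  ∃-card-missing : ∀ s → ∃ λ j → lookup (card j) s ≡ false
  ∃-card-missing s =
    let i , s∈i      = ∃-card-through s
        t , t≢s , t∈i = 2≤count⇒∃≢ (lookup (card i)) (subst (2 ≤_) (∣p∣≡count (card i)) (D3 i)) s
        j , j≢i , t∈j = 2≤count⇒∃≢ (λ j → lookup (card j) t) (subst (2 ≤_) (mult≡∑χ t) (D2 t)) i
    in j , ¬-not (λ s∈j → j≢i (card-through-two-unique (t≢s ∘ sym) s∈j t∈j s∈i t∈i))

  mult≤n : ∀ s → mult D s ≤ n
  mult≤n s = let j₀ , s∉j₀ = ∃-card-missing s in begin
    mult D s                                           ≡⟨ mult≡∑χ s ⟩
    ∑[ j < c ] χ j s                                   ≡⟨ sum-cong-≗ (through-s-meets j₀ s∉j₀) ⟩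
    ∑[ j < c ] (χ j s * ∑[ t < ℓ ] (χ j t * χ j₀ t))   ≡⟨ sum-cong-≗ (λ j → *-distribˡ-sum (χ j s) (λ t → χ j t * χ j₀ t)) ⟩
    ∑[ j < c ] ∑[ t < ℓ ] (χ j s * (χ j t * χ j₀ t))   ≡⟨ ∑-comm (λ j t → χ j s * (χ j t * χ j₀ t)) ⟩
    ∑[ t < ℓ ] ∑[ j < c ] (χ j s * (χ j t * χ j₀ t))   ≡⟨ sum-cong-≗ (λ t → pull-out j₀ t) ⟨
    ∑[ t < ℓ ] (∑[ j < c ] (χ j s * χ j t) * χ j₀ t)   ≤⟨ sum-mono-≤ (at-most-one-through-s j₀ s∉j₀) ⟩
    ∑[ t < ℓ ] χ j₀ t                                  ≡⟨ ∑χ≡n j₀ ⟩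
    n                                                  ∎
    where
    open ≤-Reasoning
    through-s-meets : ∀ j₀ → lookup (card j₀) s ≡ false → ∀ j → χ j s ≡ χ j s * ∑[ t < ℓ ] (χ j t * χ j₀ t)
    through-s-meets j₀ s∉j₀ j with lookup (card j) s in s∈j
    ... | false = refl
    ... | true  = sym (trans (+-identityʳ _) (∑ₛχᵢχⱼ≡1 (λ { refl → contradiction (trans (sym s∈j) s∉j₀) λ () })))
    pull-out : ∀ j₀ t → ∑[ j < c ] (χ j s * χ j t) * χ j₀ t ≡ ∑[ j < c ] (χ j s * (χ j t * χ j₀ t))
    pull-out j₀ t = trans (*-distribʳ-sum (χ j₀ t) (λ j → χ j s * χ j t))
                          (sum-cong-≗ (λ j → *-assoc (χ j s) (χ j t) (χ j₀ t)))
    at-most-one-through-s : ∀ j₀ → lookup (card j₀) s ≡ false → ∀ t → ∑[ j < c ] (χ j s * χ j t) * χ j₀ t ≤ χ j₀ t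
    at-most-one-through-s j₀ s∉j₀ t with lookup (card j₀) t in t∈j₀
    ... | false = ≤-reflexive (*-zeroʳ (∑[ j < c ] (χ j s * χ j t)))
    ... | true  = ≤-trans (≤-reflexive (*-identityʳ _)) (∑ⱼχₛχₜ≤1 (λ { refl → contradiction (trans (sym t∈j₀) s∉j₀) λ () }))

  ∑χ*mult≡n+[c∸1] : ∀ i → ∑[ s < ℓ ] (χ i s * mult D s) ≡ n + (c ∸ 1)
  ∑χ*mult≡n+[c∸1] i = begin
    ∑[ s < ℓ ] (χ i s * mult D s)            ≡⟨ sum-cong-≗ (λ s → cong (χ i s *_) (mult≡∑χ s)) ⟩
    ∑[ s < ℓ ] (χ i s * ∑[ j < c ] χ j s)    ≡⟨ sum-cong-≗ (λ s → *-distribˡ-sum (χ i s) (λ j → χ j s)) ⟩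
    ∑[ s < ℓ ] ∑[ j < c ] (χ i s * χ j s)    ≡⟨ ∑-comm (λ s j → χ i s * χ j s) ⟩
    ∑[ j < c ] ∑[ s < ℓ ] (χ i s * χ j s)    ≡⟨ sum-except-≡ _ i (λ j j≢i → ∑ₛχᵢχⱼ≡1 (j≢i ∘ sym)) ⟩
    ∑[ s < ℓ ] (χ i s * χ i s) + (c ∸ 1) * 1 ≡⟨ cong₂ _+_ (∑ₛχᵢχᵢ≡n i) (*-identityʳ (c ∸ 1)) ⟩
    n + (c ∸ 1)                              ∎
    where open ≡-Reasoning

  n*μ≤n+[c∸1] : ∀ {μ} → Fin c → (∀ s → μ ≤ mult D s) → n * μ ≤ n + (c ∸ 1)
  n*μ≤n+[c∸1] {μ} i μ≤mult = begin
    n * μ                          ≡⟨ cong (_* μ) (∑χ≡n i) ⟨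
    (∑[ s < ℓ ] χ i s) * μ         ≡⟨ *-distribʳ-sum μ (χ i) ⟩
    ∑[ s < ℓ ] (χ i s * μ)         ≤⟨ sum-mono-≤ (λ s → *-monoʳ-≤ (χ i s) (μ≤mult s)) ⟩
    ∑[ s < ℓ ] (χ i s * mult D s)  ≡⟨ ∑χ*mult≡n+[c∸1] i ⟩
    n + (c ∸ 1)                    ∎
    where open ≤-Reasoning

  n+[c∸1]≤n*M : ∀ {M} → Fin c → (∀ s → mult D s ≤ M) → n + (c ∸ 1) ≤ n * M
  n+[c∸1]≤n*M {M} i mult≤M = begin
    n + (c ∸ 1)                    ≡⟨ ∑χ*mult≡n+[c∸1] i ⟨
    ∑[ s < ℓ ] (χ i s * mult D s)  ≤⟨ sum-mono-≤ (λ s → *-monoʳ-≤ (χ i s) (mult≤M s)) ⟩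
    ∑[ s < ℓ ] (χ i s * M)         ≡⟨ *-distribʳ-sum M (χ i) ⟨
    (∑[ s < ℓ ] χ i s) * M         ≡⟨ cong (_* M) (∑χ≡n i) ⟩
    n * M                          ∎
    where open ≤-Reasoning

  mult*n≤mult+[ℓ∸1] : ∀ s → mult D s * n ≤ mult D s + (ℓ ∸ 1)
  mult*n≤mult+[ℓ∸1] s = begin
    mult D s * n                             ≡⟨ cong (_* n) (mult≡∑χ s) ⟩
    (∑[ j < c ] χ j s) * n                   ≡⟨ *-distribʳ-sum n (λ j → χ j s) ⟩
    ∑[ j < c ] (χ j s * n)                   ≡⟨ sum-cong-≗ (λ j → cong (χ j s *_) (∑χ≡n j)) ⟨
    ∑[ j < c ] (χ j s * ∑[ t < ℓ ] χ j t)    ≡⟨ sum-cong-≗ (λ j → *-distribˡ-sum (χ j s) (χ j)) ⟩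
    ∑[ j < c ] ∑[ t < ℓ ] (χ j s * χ j t)    ≡⟨ ∑-comm (λ j t → χ j s * χ j t) ⟩
    ∑[ t < ℓ ] ∑[ j < c ] (χ j s * χ j t)    ≤⟨ sum-except-≤ _ s (λ t t≢s → ∑ⱼχₛχₜ≤1 (t≢s ∘ sym)) ⟩
    ∑[ j < c ] (χ j s * χ j s) + (ℓ ∸ 1) * 1 ≡⟨ cong₂ _+_ (sum-cong-≗ (λ j → 𝟙-idem (lookup (card j) s))) (*-identityʳ (ℓ ∸ 1)) ⟩
    ∑[ j < c ] χ j s + (ℓ ∸ 1)               ≡⟨ cong (_+ (ℓ ∸ 1)) (mult≡∑χ s) ⟨
    mult D s + (ℓ ∸ 1)                       ∎
    where open ≤-Reasoning

mainTheorem8 : ∀ {ℓ c n} (D : Deck ℓ c n) (μ M : ℕ) → IsMinMult D μ → IsMaxMult D M →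
      ((n + 1 ≤ n * (μ ∸ 1) + 1) × (n * (μ ∸ 1) + 1 ≤ c) × (c ≤ n * (M ∸ 1) + 1) × (n * (M ∸ 1) + 1 ≤ Δ n))
    × ((c ≤ n * (M ∸ 1) + 1) × (n * (M ∸ 1) + 1 ≤ M * (n ∸ 1) + 1) × (M * (n ∸ 1) + 1 ≤ ℓ))
    × (∃ λ k → n + 1 ≤ ∣ multSet D k ∣)
mainTheorem8 {ℓ} {c} {n} D μ M ((s₀ , mult≡μ) , μ≤mult) ((s₁ , mult≡M) , mult≤M) =
    ( +-monoˡ-≤ 1 (2≤m⇒n≤n*[m∸1] n 2≤μ)
    , m*n≤m+[o∸1]⇒m*[n∸1]+1≤o n μ 1≤c (n*μ≤n+[c∸1] D i₀ μ≤mult)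
    , c≤n*[M∸1]+1
    , +-monoˡ-≤ 1 (m≤n⇒n*[m∸1]≤n*n∸n M≤n) )
  , (c≤n*[M∸1]+1 , +-monoˡ-≤ 1 (m≤n⇒n*[m∸1]≤m*[n∸1] M≤n) , M*[n∸1]+1≤ℓ)
  , (let k , n<∣fibre∣ = pigeonhole (mult D) 2 (M ∸ 1) (Deck.D2 D) mult<2+[M∸1]
                               (m≤n∧m*[n∸1]+1≤o⇒[m∸1]*n<o M≤n M*[n∸1]+1≤ℓ)
     in 2 + toℕ k , subst (_≤ ∣ multSet D (2 + toℕ k) ∣) (+-comm 1 n) n<∣fibre∣)
  where
  i₀ : Fin c
  i₀ = let i , _ = ∃-card-through D s₀ in i
  1≤c : 1 ≤ c
  1≤c = ≤-trans (s≤s z≤n) (toℕ<n i₀)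
  2≤μ : 2 ≤ μ
  2≤μ = subst (2 ≤_) mult≡μ (Deck.D2 D s₀)
  M≤n : M ≤ n
  M≤n = subst (_≤ n) mult≡M (mult≤n D s₁)
  c≤n*[M∸1]+1 : c ≤ n * (M ∸ 1) + 1
  c≤n*[M∸1]+1 = m+[o∸1]≤m*n⇒o≤m*[n∸1]+1 n M (n+[c∸1]≤n*M D i₀ mult≤M)
  M*[n∸1]+1≤ℓ : M * (n ∸ 1) + 1 ≤ ℓ
  M*[n∸1]+1≤ℓ = m*n≤m+[o∸1]⇒m*[n∸1]+1≤o M n (Deck.D5 D)
                  (subst (λ m → m * n ≤ m + (ℓ ∸ 1)) mult≡M (mult*n≤mult+[ℓ∸1] D s₁))
  mult<2+[M∸1] : ∀ s → mult D s < 2 + (M ∸ 1)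
  mult<2+[M∸1] s = s≤s (≤-trans (mult≤M s) (m≤n+m∸n M 1))
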